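{- Let $k\ge 2$ be an integer and let $\Gamma=(V,E)$ be a reflexive locally finite $k$-separable graph. Then $\Gamma$ is $(k-1)$-separable and $\kappa_{k-1}(\Gamma)\le\kappa_k(\Gamma)$. Moreover, if $\kappa_{k-1}(\Gamma)=\kappa_k(\Gamma)$, then the set of $k$-fragments of $\Gamma$ equals the set of those $(k-1)$-fragments $F$ of $\Gamma$ with $k\le\min(|F|,|\nabla(F)|)$.
   Context: A graph is a pair $\Gamma=(V,E)$ with $V$ a set and $E\subseteq V\times V$. For $X\subseteq V$, $\Gamma(X)=\{y\in V: (x,y)\in E \text{ for some } x\in X\}$ and $\Gamma(x)=\Gamma(\{x\})$. $\Gamma$ is reflexive if $(x,x)\in E$ for all $x\in V$. The reverse graph is $\Gamma^-=(V,E^-)$ with $E^-=\{(x,y):(y,x)\in E\}$. $\Gamma$ is locally finite if $\Gamma(x)$ and $\Gamma^-(x)$ are finite for every $x\in V$. The board of $X$ is $\partial(X)=\Gamma(X)\setminus X$ and the exterior of $X$ is $\nabla(X)=V\setminus\Gamma(X)$. For an integer $k\ge1$, $\Gamma$ is $k$-separable if there is a finite $X\subseteq V$ with $|X|\ge k$ and $|\nabla(X)|\ge k$; in that case $\kappa_k(\Gamma)=\min\{|\partial(X)|: X \text{ finite}, |X|\ge k, |\nabla(X)|\ge k\}$. A $k$-fragment of $\Gamma$ is a finite $X\subseteq V$ with $|X|\ge k$, $|\nabla(X)|\ge k$ and $|\partial(X)|=\kappa_k(\Gamma)$. -}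

module Defs where

open import Data.Nat using (ℕ; _≤_)
open import Data.List using (List; length)
open import Data.List.Membership.Propositional using (_∈_)
open import Data.List.Relation.Unary.All using (All)
open import Data.List.Relation.Unary.Unique.Propositional using (Unique)
open import Data.Product using (Σ; ∃; _×_)
open import Relation.Nullary using (¬_)
open import Relation.Binary.PropositionalEquality using (_≡_)
open import Function.Bundles using (_⇔_)

Subset : Set → Set₁
Subset V = V → Set

IsFinite : {V : Set} → Subset V → Set
IsFinite {V} P = ∃ λ (xs : List V) → ∀ y → (y ∈ xs) ⇔ P y

HasSize : {V : Set} → Subset V → ℕ → Set
HasSize {V} P n = ∃ λ (xs : List V) → Unique xs × (∀ y → (y ∈ xs) ⇔ P y) × length xs ≡ n

-- |P| ≥ k : P contains k pairwise distinct elements (P may be infinite).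
AtLeast : {V : Set} → Subset V → ℕ → Set
AtLeast {V} P k = ∃ λ (xs : List V) → Unique xs × All P xs × length xs ≡ k

module _ {V : Set} (E : V → V → Set) where

  Nb : Subset V → Subset V
  Nb X y = ∃ λ x → X x × E x y

  Out : V → Subset V
  Out x y = E x y

  In : V → Subset V
  In x y = E y x

  Board : Subset V → Subset V
  Board X y = Nb X y × ¬ X y

  Exterior : Subset V → Subset V
  Exterior X y = ¬ Nb X y

  IsReflexive : Set
  IsReflexive = ∀ x → E x x

  LocallyFinite : Set
  LocallyFinite = ∀ x → IsFinite (Out x) × IsFinite (In x)

  Admissible : ℕ → Subset V → Set
  Admissible k X = IsFinite X × AtLeast X k × AtLeast (Exterior X) k

  Separable : ℕ → Set₁
  Separable k = ∃ λ (X : Subset V) → Admissible k X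

  IsKappa : ℕ → ℕ → Set₁
  IsKappa k m =
    (∃ λ (X : Subset V) → Admissible k X × HasSize (Board X) m)
    × (∀ (X : Subset V) → Admissible k X → ∀ n → HasSize (Board X) n → m ≤ n)

  Fragment : ℕ → Subset V → Set₁
  Fragment k X = Admissible k X × ∃ λ m → IsKappa k m × HasSize (Board X) m

module Submission where

-- Everything follows from one monotonicity fact: a set with at
-- least k distinct elements has at least k ∸ 1 of them (drop the head of the
-- witnessing list).  Hence every k-admissible set X (finite, |X| ≥ k,
-- |∇(X)| ≥ k) is also (k ∸ 1)-admissible, so
--   * k-separability gives (k ∸ 1)-separability, and
--   * κ_{k∸1}, a minimum over a larger family of sets, is at most κ_k.
-- Since κ_k is a minimum, it is unique; so when κ_{k∸1} = κ_k the two
-- fragment notions differ only in the admissibility condition, and a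
-- (k ∸ 1)-fragment F is a k-fragment exactly when |F| ≥ k and |∇(F)| ≥ k.

open import Defs
open import Data.Nat using (ℕ; _≤_; _∸_)
open import Data.Nat.Properties using (≤-antisym)
open import Data.Product using (_×_; _,_)
open import Data.List using ([]; _∷_)
open import Data.List.Relation.Unary.All using ([]; _∷_)
open import Data.List.Relation.Unary.AllPairs using ([]; _∷_)
open import Relation.Binary.PropositionalEquality using (_≡_; refl; sym; subst)
open import Function.Bundles using (_⇔_; mk⇔)

atLeast-pred : {V : Set} (P : Subset V) (k : ℕ) → AtLeast P k → AtLeast P (k ∸ 1)
atLeast-pred P k ([] , unique , all , refl) = [] , unique , all , refl
atLeast-pred P k ((x ∷ xs) , (_ ∷ unique) , (_ ∷ all) , refl) = xs , unique , all , refl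

module _ {V : Set} (E : V → V → Set) where

  admissible-pred : ∀ k X → Admissible E k X → Admissible E (k ∸ 1) X
  admissible-pred k X (finite , big , bigExterior) =
    finite , atLeast-pred X k big , atLeast-pred (Exterior E X) k bigExterior

  separable-pred : ∀ k → Separable E k → Separable E (k ∸ 1)
  separable-pred k (X , adm) = X , admissible-pred k X adm

  kappa-unique : ∀ k m n → IsKappa E k m → IsKappa E k n → m ≡ n
  kappa-unique k m n ((X , admX , sizeX) , minM) ((Y , admY , sizeY) , minN) =
    ≤-antisym (minM Y admY n sizeY) (minN X admX m sizeX)

  -- κ_{k∸1} ≤ κ_k: a set attaining κ_k is a competitor for κ_{k∸1}.
  kappa-pred-≤ : ∀ k m m′ → IsKappa E k m → IsKappa E (k ∸ 1) m′ → m′ ≤ m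
  kappa-pred-≤ k m m′ ((Y , admY , sizeY) , _) (_ , min′) =
    min′ Y (admissible-pred k Y admY) m sizeY

  board-size : ∀ j F m₀ m → IsKappa E j m₀ → IsKappa E j m
             → HasSize (Board E F) m₀ → HasSize (Board E F) m
  board-size j F m₀ m κ₀ κ = subst (HasSize (Board E F)) (kappa-unique j m₀ m κ₀ κ)

  fragment-pred-⇔ : ∀ k m m′ → IsKappa E k m → IsKappa E (k ∸ 1) m′ → m′ ≡ m
    → ∀ F → Fragment E k F ⇔ (Fragment E (k ∸ 1) F × AtLeast F k × AtLeast (Exterior E F) k)
  fragment-pred-⇔ k m m′ κ κ′ m′≡m F = mk⇔ to from
    where
    to : Fragment E k F → Fragment E (k ∸ 1) F × AtLeast F k × AtLeast (Exterior E F) k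
    to (adm@(_ , big , bigExterior) , m₀ , κ₀ , size) =
      (admissible-pred k F adm , m′ , κ′ ,
        subst (HasSize (Board E F)) (sym m′≡m) (board-size k F m₀ m κ₀ κ size))
      , big , bigExterior
    from : Fragment E (k ∸ 1) F × AtLeast F k × AtLeast (Exterior E F) k → Fragment E k F
    from (((finite , _ , _) , m₁ , κ₁ , size) , big , bigExterior) =
      (finite , big , bigExterior) , m , κ ,
        subst (HasSize (Board E F)) m′≡m (board-size (k ∸ 1) F m₁ m′ κ₁ κ′ size)

lemma3p1 : {V : Set} (E : V → V → Set) (k : ℕ) → 2 ≤ k
    → IsReflexive E → LocallyFinite E → Separable E k
    → Separable E (k ∸ 1)
      × (∀ (m m′ : ℕ) → IsKappa E k m → IsKappa E (k ∸ 1) m′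
          → m′ ≤ m
            × (m′ ≡ m → ∀ (F : Subset V)
                 → Fragment E k F ⇔ (Fragment E (k ∸ 1) F × AtLeast F k × AtLeast (Exterior E F) k)))
lemma3p1 E k _ _ _ separable =
  separable-pred E k separable ,
  λ m m′ κ κ′ → kappa-pred-≤ E k m m′ κ κ′ , λ m′≡m → fragment-pred-⇔ E k m m′ κ κ′ m′≡m
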